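{- Let $G$ be a $P_6$-free graph and let $\Pi$ be an induced subgraph of $G$ that is a pyramid with presentation $(a, x_1, x_2, x_3, y_1, y_2, y_3)$. Let $Y = \{y_1,y_2,y_3\}$ and let $Z$ be the set of vertices $z \in V(G) \setminus V(\Pi)$ that have at least one neighbour in $V(\Pi)$ and such that $N_G(z) \cap V(\Pi)$ is not a clique. Let $G'$ be the component of $G - Z$ containing $\Pi$. Then $\Pi$ is simplicial in $G'$, and with $A = N_{G'}(a) \setminus V(\Pi)$ and $B = \{ b \in V(G') \setminus V(\Pi) : N_{G'}(b) \cap V(\Pi) = Y\}$ (the set of $\Pi$-basic vertices of $G'$), the sets $A$, $B$, $V(\Pi)$ form a partition of $V(G')$. Moreover, if $G$ is also $K_{2,t}$-free for some integer $t \geq 2$, then $\alpha(Z) \leq 12(t-1)$.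
   Context: All graphs are finite and simple; $P_6$ is the path on $6$ vertices and $K_{2,t}$ is the complete bipartite graph with parts of sizes $2$ and $t$; $H$-free means no induced subgraph isomorphic to $H$. For $t\ge 2$, a $t$-pyramid is a graph on vertices $a, x_1,\dots,x_t, y_1,\dots,y_t$ with edge set $\{a x_i : i\in[t]\} \cup \{x_i y_i : i \in [t]\} \cup \{y_i y_j : i \neq j\}$; the tuple $(a,x_1,\dots,x_t,y_1,\dots,y_t)$ is its presentation, $a$ its apex, and $\{y_1,\dots,y_t\}$ its base. A pyramid is a $3$-pyramid. If $\Pi$ is an induced pyramid in a graph $H$, then $\Pi$ is simplicial in $H$ if for every $v \in V(H)\setminus V(\Pi)$ the set $N_H(v) \cap V(\Pi)$ is a nonempty clique; a vertex $v \in V(H)\setminus V(\Pi)$ is $\Pi$-basic if $N_H(v) \cap V(\Pi)$ equals the base of $\Pi$. $\alpha(X)$ denotes the maximum size of an independent set of $G$ contained in $X$. -}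

module Defs where

open import Data.Nat using (ℕ; suc)
open import Data.Fin using (Fin; toℕ)
open import Data.Sum using (_⊎_; inj₁; inj₂)
open import Data.Product using (Σ; ∃; _×_; _,_)
open import Data.Unit using (⊤)
open import Data.Empty using (⊥)
open import Data.List using (List)
open import Data.List.Membership.Propositional using (_∈_)
open import Data.List.Relation.Unary.Unique.Propositional using (Unique)
open import Relation.Nullary using (¬_; Dec)
open import Relation.Binary.PropositionalEquality using (_≡_; _≢_)
open import Function.Bundles using (_⇔_)

record Graph (n : ℕ) : Set₁ where
  field
    Adj    : Fin n → Fin n → Set
    adj?   : ∀ u v → Dec (Adj u v)
    sym    : ∀ {u v} → Adj u v → Adj v u
    irrefl : ∀ {u} → ¬ Adj u u
open Graph public

record InducedCopy {W : Set} (HAdj : W → W → Set) {n : ℕ} (G : Graph n) : Set where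
  field
    emb     : W → Fin n
    inj     : ∀ {u v} → emb u ≡ emb v → u ≡ v
    adjIff  : ∀ u v → Adj G (emb u) (emb v) ⇔ HAdj u v
open InducedCopy public

Free : {W : Set} → (W → W → Set) → {n : ℕ} → Graph n → Set
Free HAdj G = ¬ InducedCopy HAdj G

P6Adj : Fin 6 → Fin 6 → Set
P6Adj i j = (suc (toℕ i) ≡ toℕ j) ⊎ (suc (toℕ j) ≡ toℕ i)

K2Adj : (t : ℕ) → (Fin 2 ⊎ Fin t) → (Fin 2 ⊎ Fin t) → Set
K2Adj t (inj₁ _) (inj₂ _) = ⊤
K2Adj t (inj₂ _) (inj₁ _) = ⊤
K2Adj t _        _        = ⊥

data PV : Set where
  apex : PV
  xv   : Fin 3 → PV
  yv   : Fin 3 → PV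

PyrAdj : PV → PV → Set
PyrAdj apex   (xv _) = ⊤
PyrAdj (xv _) apex   = ⊤
PyrAdj (xv i) (yv j) = i ≡ j
PyrAdj (yv i) (xv j) = i ≡ j
PyrAdj (yv i) (yv j) = i ≢ j
PyrAdj _      _      = ⊥

Pyramid : {n : ℕ} → Graph n → Set
Pyramid G = InducedCopy PyrAdj G

module _ {n : ℕ} (G : Graph n) where

  VSet : Set₁
  VSet = Fin n → Set

  IsClique : VSet → Set
  IsClique S = ∀ u v → S u → S v → u ≢ v → Adj G u v

  data Reach (S : VSet) (s : Fin n) : Fin n → Set where
    here : S s → Reach S s s
    step : ∀ {u v} → Reach S s u → Adj G u v → S v → Reach S s v

  IndepIn : VSet → List (Fin n) → Set
  IndepIn S L = Unique L × (∀ v → v ∈ L → S v)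
                × (∀ u v → u ∈ L → v ∈ L → ¬ Adj G u v)

  module _ (P : Pyramid G) where

    InΠ : VSet
    InΠ v = ∃ λ u → emb P u ≡ v

    InY : VSet
    InY v = ∃ λ i → emb P (yv i) ≡ v

    a : Fin n
    a = emb P apex

    NΠ : Fin n → VSet
    NΠ z w = InΠ w × Adj G z w

    Z : VSet
    Z z = ¬ InΠ z × (∃ λ w → NΠ z w) × ¬ IsClique (NΠ z)

    -- V(G'): the component of G - Z containing Π (i.e. containing the apex a,
    -- Π being connected and disjoint from Z)
    InG' : VSet
    InG' v = Reach (λ w → ¬ Z w) a v

    NΠ' : Fin n → VSet
    NΠ' v w = InG' w × NΠ v w

    Simplicial' : Set
    Simplicial' = ∀ v → InG' v → ¬ InΠ v →
                  (∃ λ w → NΠ' v w) × IsClique (NΠ' v)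

    InA : VSet
    InA v = InG' v × ¬ InΠ v × InG' a × Adj G v a

    InB : VSet
    InB v = InG' v × ¬ InΠ v × (∀ w → NΠ' v w ⇔ InY w)

    PartitionG' : Set
    PartitionG' =
      (∀ v → InA v → InG' v) × (∀ v → InB v → InG' v) × (∀ v → InΠ v → InG' v)
      × (∀ v → InG' v → InA v ⊎ InB v ⊎ InΠ v)
      × (∀ v → ¬ (InA v × InB v)) × (∀ v → ¬ (InA v × InΠ v))
      × (∀ v → ¬ (InB v × InΠ v))

-- Every vertex of the pyramid has two non-adjacent neighbours, and every edge p q of the
-- pyramid starts an induced path p q r s.  Hence if u ∉ Π sees a nonempty clique of Π, some
-- neighbour p of u in Π has a neighbour q that u misses, and a neighbour v of u seeing nothing
-- in Π would give the induced P6  v u p q r s.  Following a path of G − Z from the apex, every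
-- vertex of G′ − Π therefore sees Π, in a clique since it is not in Z.  Such a vertex v missing
-- the apex sees no x_i (else  v x_i a x_j y_j y_k  is an induced P6) and all of Y (else
-- v y_i y_j x_j a x_k  is one).  Finally every z ∈ Z sees both ends of one of the 12 non-edges
-- of Π, and by K_{2,t}-freeness at most t − 1 vertices of an independent set do so for each.

module Submission where

open import Defs
open import Data.Nat using (ℕ; _≤_; _*_; _∸_)
open import Data.List using (List; length)
open import Data.Product using (_×_)
open import Data.Fin using (Fin)

open import Data.Nat using (suc; _<_; _<?_; z≤n; s≤s; s≤s⁻¹)
open import Data.Nat.Properties
  using (≤-refl; ≤-trans; n≤1+n; suc-injective; ≮⇒≥; +-mono-≤; +-mono-<-≤; +-mono-≤-<) renaming (_≟_ to _≟ℕ_)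
open import Data.Nat.ListAction using (sum)
open import Data.Fin using (zero; suc; toℕ; inject≤; _≟_)
open import Data.Fin.Properties using (all?; any?; inject≤-injective)
open import Data.List using (map; filter; lookup; allFin; _++_; [_])
open import Data.List.Properties using (filter-accept)
open import Data.List.Membership.Propositional using (_∈_; lose)
open import Data.List.Membership.Propositional.Properties
  using (∈-map⁺; ∈-++⁺ˡ; ∈-++⁺ʳ; ∈-filter⁺; ∈-filter⁻; ∈-lookup; ∈-allFin)
open import Data.List.Relation.Unary.Any as Any using (Any; here; there)
open import Data.List.Relation.Unary.All as All using (All)
open import Data.List.Relation.Unary.Unique.Propositional using (Unique)
import Data.List.Relation.Unary.Unique.Propositional.Properties as Unique
open import Data.Product using (∃; ∃₂; _,_; proj₁; proj₂)
open import Data.Sum as Sum using (_⊎_; inj₁; inj₂)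
open import Data.Unit using (tt)
open import Data.Empty using (⊥-elim)
open import Data.Bool using (true; false)
open import Function using (_∘_)
open import Function.Bundles using (_⇔_; mk⇔; Equivalence)
import Function.Properties.Equivalence as ⇔
open import Relation.Nullary using (¬_; Dec; yes; no; does; ¬?)
open import Relation.Nullary.Decidable using (map′; _×-dec_; _⊎-dec_; _→-dec_; toWitness)
open import Relation.Unary using (Decidable)
open import Relation.Binary.PropositionalEquality using (_≡_; _≢_; refl; cong; subst)
  renaming (sym to ≡-sym)

module _ where
  open import Data.List using ([]; _∷_)
  open import Data.List.Relation.Unary.AllPairs using (_∷_)

  Unique-lookup-injective : ∀ {A : Set} {xs : List A} → Unique xs →
                            ∀ {i j} → lookup xs i ≡ lookup xs j → i ≡ j
  Unique-lookup-injective (_  ∷ _) {zero}  {zero}  _  = refl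
  Unique-lookup-injective (x∉ ∷ _) {zero}  {suc j} eq = ⊥-elim (All.lookup x∉ (∈-lookup j) eq)
  Unique-lookup-injective (x∉ ∷ _) {suc i} {zero}  eq = ⊥-elim (All.lookup x∉ (∈-lookup i) (≡-sym eq))
  Unique-lookup-injective (_  ∷ u) {suc i} {suc j} eq = cong suc (Unique-lookup-injective u eq)

  orderedPairs : ∀ {A : Set} → List A → List (A × A)
  orderedPairs []       = []
  orderedPairs (x ∷ xs) = map (x ,_) xs ++ orderedPairs xs

  ∈-orderedPairs : ∀ {A : Set} {x y : A} {xs} → x ≢ y → x ∈ xs → y ∈ xs →
                   (x , y) ∈ orderedPairs xs ⊎ (y , x) ∈ orderedPairs xs
  ∈-orderedPairs x≢y (here refl) (here refl) = ⊥-elim (x≢y refl)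
  ∈-orderedPairs _   (here refl) (there y∈)  = inj₁ (∈-++⁺ˡ (∈-map⁺ _ y∈))
  ∈-orderedPairs _   (there x∈)  (here refl) = inj₂ (∈-++⁺ˡ (∈-map⁺ _ x∈))
  ∈-orderedPairs x≢y (there x∈) (there y∈) =
    Sum.map (∈-++⁺ʳ _) (∈-++⁺ʳ _) (∈-orderedPairs x≢y x∈ y∈)

  module _ {A : Set} {f g : A → ℕ} (f≤g : ∀ a → f a ≤ g a) where

    sum-map-≤ : ∀ as → sum (map f as) ≤ sum (map g as)
    sum-map-≤ []       = z≤n
    sum-map-≤ (a ∷ as) = +-mono-≤ (f≤g a) (sum-map-≤ as)

    sum-map-< : ∀ {as} → Any (λ a → f a < g a) as → sum (map f as) < sum (map g as)
    sum-map-< {a ∷ as} (here fa<ga) = +-mono-<-≤ fa<ga (sum-map-≤ as)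
    sum-map-< {a ∷ as} (there any)  = +-mono-≤-< (f≤g a) (sum-map-< any)

  sum-map-≤-length* : ∀ {A : Set} {f : A → ℕ} {c} as → (∀ a → a ∈ as → f a ≤ c) →
                      sum (map f as) ≤ length as * c
  sum-map-≤-length* []       _   = z≤n
  sum-map-≤-length* (a ∷ as) f≤c = +-mono-≤ (f≤c a (here refl)) (sum-map-≤-length* as (λ b → f≤c b ∘ there))

  module _ {A B : Set} {R : A → B → Set} (R? : ∀ a b → Dec (R a b)) where

    count : A → List B → ℕ
    count a bs = length (filter (R? a) bs)

    count-∷-≤ : ∀ b bs a → count a bs ≤ count a (b ∷ bs)
    count-∷-≤ b bs a with does (R? a b)
    ... | true  = n≤1+n _
    ... | false = ≤-refl

    count-∷-< : ∀ {b} bs {a} → R a b → count a bs < count a (b ∷ bs)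
    count-∷-< bs {a} r rewrite filter-accept (R? a) {xs = bs} r = ≤-refl

    length≤sum-count : ∀ as bs → All (λ b → Any (λ a → R a b) as) bs →
                       length bs ≤ sum (map (λ a → count a bs) as)
    length≤sum-count as []       _              = z≤n
    length≤sum-count as (b ∷ bs) (hit All.∷ hits) =
      ≤-trans (s≤s (length≤sum-count as bs hits))
              (sum-map-< (count-∷-≤ b bs) (Any.map (count-∷-< bs) hit))

Consecutive : ∀ {k} → Fin k → Fin k → Set
Consecutive i j = suc (toℕ i) ≡ toℕ j ⊎ suc (toℕ j) ≡ toℕ i

record IsInducedPath {V : Set} (E : V → V → Set) {k : ℕ} (w : Fin k → V) : Set where
  field
    injective        : ∀ {i j} → w i ≡ w j → i ≡ j
    adj⇔consecutive : ∀ i j → E (w i) (w j) ⇔ Consecutive i j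
open IsInducedPath

_⇔-dec_ : ∀ {A B : Set} → Dec A → Dec B → Dec (A ⇔ B)
a? ⇔-dec b? = map′ (λ (f , g) → mk⇔ f g) (λ e → Equivalence.to e , Equivalence.from e)
                   ((a? →-dec b?) ×-dec (b? →-dec a?))

consecutive? : ∀ {k} (i j : Fin k) → Dec (Consecutive i j)
consecutive? i j = (suc (toℕ i) ≟ℕ toℕ j) ⊎-dec (suc (toℕ j) ≟ℕ toℕ i)

isInducedPath? : ∀ {V : Set} {E : V → V → Set} → (∀ u v → Dec (E u v)) → ((u v : V) → Dec (u ≡ v)) →
                 ∀ {k} (w : Fin k → V) → Dec (IsInducedPath E w)
isInducedPath? E? _≟V_ w =
  map′ (λ (inj , adj) → record { injective = inj _ _ ; adj⇔consecutive = adj })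
       (λ p → (λ _ _ → injective p) , adj⇔consecutive p)
       (all? (λ i → all? λ j → (w i ≟V w j) →-dec (i ≟ j))
        ×-dec all? (λ i → all? λ j → E? (w i) (w j) ⇔-dec consecutive? i j))

consecutive-suc : ∀ {k} {i j : Fin k} → Consecutive (suc i) (suc j) ⇔ Consecutive i j
consecutive-suc = mk⇔ (Sum.map suc-injective suc-injective) (Sum.map (cong suc) (cong suc))

InducedCopy-inducedPath : ∀ {W : Set} {H : W → W → Set} {n} {G : Graph n} (c : InducedCopy H G) →
                          ∀ {k} {w : Fin k → W} → IsInducedPath H w → IsInducedPath (Adj G) (emb c ∘ w)
InducedCopy-inducedPath c {w = w} p = record
  { injective        = injective p ∘ inj c
  ; adj⇔consecutive = λ i j → ⇔.trans (adjIff c (w i) (w j)) (adj⇔consecutive p i j) }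

module _ {n} (G : Graph n) where
  open import Data.Vec.Functional using (_∷_)

  inducedPath⇒copy : ∀ {k} {w : Fin k → Fin n} → IsInducedPath (Adj G) w → InducedCopy Consecutive G
  inducedPath⇒copy {w = w} p = record { emb = w ; inj = injective p ; adjIff = adj⇔consecutive p }

  ∷-inducedPath : ∀ {k u} {w : Fin (suc k) → Fin n} → IsInducedPath (Adj G) w →
                  (∀ i → u ≢ w i) → Adj G u (w zero) → (∀ i → ¬ Adj G u (w (suc i))) →
                  IsInducedPath (Adj G) (u ∷ w)
  ∷-inducedPath {k} {u} {w} p fresh u~w₀ u≁ = record { injective = inj′ ; adj⇔consecutive = adj′ }
    where
    inj′ : ∀ {i j} → (u ∷ w) i ≡ (u ∷ w) j → i ≡ j
    inj′ {zero}  {zero}  _  = refl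
    inj′ {zero}  {suc j} eq = ⊥-elim (fresh j eq)
    inj′ {suc i} {zero}  eq = ⊥-elim (fresh i (≡-sym eq))
    inj′ {suc i} {suc j} eq = cong suc (injective p eq)

    adjHead : ∀ j → Adj G u (w j) ⇔ Consecutive {suc (suc k)} zero (suc j)
    adjHead zero    = mk⇔ (λ _ → inj₁ refl) (λ _ → u~w₀)
    adjHead (suc j) = mk⇔ (⊥-elim ∘ u≁ j) λ { (inj₁ ()) ; (inj₂ ()) }

    adj′ : ∀ i j → Adj G ((u ∷ w) i) ((u ∷ w) j) ⇔ Consecutive i j
    adj′ zero    zero    = mk⇔ (⊥-elim ∘ irrefl G) λ { (inj₁ ()) ; (inj₂ ()) }
    adj′ zero    (suc j) = adjHead j
    adj′ (suc i) zero    = mk⇔ (Sum.swap ∘ Equivalence.to (adjHead i) ∘ sym G)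
                               (sym G ∘ Equivalence.from (adjHead i) ∘ Sum.swap)
    adj′ (suc i) (suc j) = ⇔.trans (adj⇔consecutive p i j) (⇔.sym consecutive-suc)

  commonNeighbours-< : ∀ {t x y} → Free (K2Adj t) G → x ≢ y → ¬ Adj G x y →
                       (L : List (Fin n)) → Unique L → (∀ z → z ∈ L → Adj G z x × Adj G z y) →
                       (∀ z z′ → z ∈ L → z′ ∈ L → ¬ Adj G z z′) → length L < t
  commonNeighbours-< {t} {x} {y} K2t-free x≢y x≁y L uniq common indep with length L <? t
  ... | yes L<t = L<t
  ... | no  L≮t = ⊥-elim (K2t-free record { emb = f ; inj = f-inj ; adjIff = f-adj })
    where
    t≤L = ≮⇒≥ L≮t

    f : Fin 2 ⊎ Fin t → Fin n
    f (inj₁ zero)    = x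
    f (inj₁ (suc _)) = y
    f (inj₂ i)       = lookup L (inject≤ i t≤L)

    f∈L : ∀ i → f (inj₂ i) ∈ L
    f∈L i = ∈-lookup (inject≤ i t≤L)

    spoke : ∀ b i → Adj G (f (inj₂ i)) (f (inj₁ b))
    spoke zero    i = proj₁ (common _ (f∈L i))
    spoke (suc _) i = proj₂ (common _ (f∈L i))

    f-inj : ∀ {u v} → f u ≡ f v → u ≡ v
    f-inj {inj₁ zero}       {inj₁ zero}       _  = refl
    f-inj {inj₁ zero}       {inj₁ (suc zero)} eq = ⊥-elim (x≢y eq)
    f-inj {inj₁ (suc zero)} {inj₁ zero}       eq = ⊥-elim (x≢y (≡-sym eq))
    f-inj {inj₁ (suc zero)} {inj₁ (suc zero)} _  = refl
    f-inj {inj₁ b} {inj₂ i} eq = ⊥-elim (irrefl G (subst (Adj G (f (inj₂ i))) eq (spoke b i)))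
    f-inj {inj₂ i} {inj₁ b} eq = ⊥-elim (irrefl G (subst (Adj G (f (inj₂ i))) (≡-sym eq) (spoke b i)))
    f-inj {inj₂ i} {inj₂ j} eq = cong inj₂ (inject≤-injective t≤L t≤L i j (Unique-lookup-injective uniq eq))

    f-adj : ∀ u v → Adj G (f u) (f v) ⇔ K2Adj t u v
    f-adj (inj₁ zero)       (inj₁ zero)       = mk⇔ (⊥-elim ∘ irrefl G) λ ()
    f-adj (inj₁ zero)       (inj₁ (suc zero)) = mk⇔ (⊥-elim ∘ x≁y) λ ()
    f-adj (inj₁ (suc zero)) (inj₁ zero)       = mk⇔ (⊥-elim ∘ x≁y ∘ sym G) λ ()
    f-adj (inj₁ (suc zero)) (inj₁ (suc zero)) = mk⇔ (⊥-elim ∘ irrefl G) λ ()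
    f-adj (inj₁ b) (inj₂ i) = mk⇔ (λ _ → tt) (λ _ → sym G (spoke b i))
    f-adj (inj₂ i) (inj₁ b) = mk⇔ (λ _ → tt) (λ _ → spoke b i)
    f-adj (inj₂ i) (inj₂ j) = mk⇔ (⊥-elim ∘ indep _ _ (f∈L i) (f∈L j)) λ ()

pyrAdj? : ∀ p q → Dec (PyrAdj p q)
pyrAdj? apex   apex   = no λ ()
pyrAdj? apex   (xv _) = yes tt
pyrAdj? apex   (yv _) = no λ ()
pyrAdj? (xv _) apex   = yes tt
pyrAdj? (xv _) (xv _) = no λ ()
pyrAdj? (xv i) (yv j) = i ≟ j
pyrAdj? (yv _) apex   = no λ ()
pyrAdj? (yv i) (xv j) = i ≟ j
pyrAdj? (yv i) (yv j) = ¬? (i ≟ j)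

xv-injective : ∀ {i j} → xv i ≡ xv j → i ≡ j
xv-injective refl = refl

yv-injective : ∀ {i j} → yv i ≡ yv j → i ≡ j
yv-injective refl = refl

_≟PV_ : (p q : PV) → Dec (p ≡ q)
apex ≟PV apex = yes refl
apex ≟PV xv _ = no λ ()
apex ≟PV yv _ = no λ ()
xv _ ≟PV apex = no λ ()
xv i ≟PV xv j = map′ (cong xv) xv-injective (i ≟ j)
xv _ ≟PV yv _ = no λ ()
yv _ ≟PV apex = no λ ()
yv _ ≟PV xv _ = no λ ()
yv i ≟PV yv j = map′ (cong yv) yv-injective (i ≟ j)

all-PV? : {Q : PV → Set} → Decidable Q → Dec (∀ p → Q p)
all-PV? Q? = map′ (λ (qa , qx , qy) → λ { apex → qa ; (xv i) → qx i ; (yv i) → qy i })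
                  (λ h → h apex , h ∘ xv , h ∘ yv)
                  (Q? apex ×-dec all? (Q? ∘ xv) ×-dec all? (Q? ∘ yv))

any-PV? : {Q : PV → Set} → Decidable Q → Dec (∃ Q)
any-PV? Q? = map′ (λ { (inj₁ q) → apex , q ; (inj₂ (inj₁ (i , q))) → xv i , q ; (inj₂ (inj₂ (i , q))) → yv i , q })
                  (λ { (apex , q) → inj₁ q ; (xv i , q) → inj₂ (inj₁ (i , q)) ; (yv i , q) → inj₂ (inj₂ (i , q)) })
                  (Q? apex ⊎-dec any? (Q? ∘ xv) ⊎-dec any? (Q? ∘ yv))

allPV : List PV
allPV = [ apex ] ++ map xv (allFin 3) ++ map yv (allFin 3)

∈-allPV : ∀ p → p ∈ allPV
∈-allPV apex   = here refl
∈-allPV (xv i) = ∈-++⁺ʳ [ apex ] (∈-++⁺ˡ (∈-map⁺ xv (∈-allFin i)))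
∈-allPV (yv i) = ∈-++⁺ʳ [ apex ] (∈-++⁺ʳ (map xv (allFin 3)) (∈-map⁺ yv (∈-allFin i)))

NonEdge : PV × PV → Set
NonEdge (p , q) = p ≢ q × ¬ PyrAdj p q

nonEdge? : Decidable NonEdge
nonEdge? (p , q) = ¬? (p ≟PV q) ×-dec ¬? (pyrAdj? p q)

nonEdges : List (PV × PV)
nonEdges = filter nonEdge? (orderedPairs allPV)

length-nonEdges : length nonEdges ≡ 12
length-nonEdges = refl

module _ where
  open import Data.Vec.Functional using (_∷_; [])

  -- Exhaustive searches, kept opaque so that later type checking never unfolds them.
  opaque
    pyramid-noSimplicialVertex : ∀ p → ∃₂ λ q q′ → PyrAdj p q × PyrAdj p q′ × NonEdge (q , q′)
    pyramid-noSimplicialVertex = toWitness {a? = all-PV? λ p → any-PV? λ q → any-PV? λ q′ →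
      pyrAdj? p q ×-dec pyrAdj? p q′ ×-dec nonEdge? (q , q′)} _

    -- The paths found are a x_j y_j y_k, x_i a x_j y_j, x_i y_i y_j x_j, y_i x_i a x_j and y_i y_j x_j a.
    pyramid-edge-startsP4 : ∀ p q → PyrAdj p q → ∃₂ λ r s → IsInducedPath PyrAdj (p ∷ q ∷ r ∷ s ∷ [])
    pyramid-edge-startsP4 = toWitness {a? = all-PV? λ p → all-PV? λ q → pyrAdj? p q →-dec
      any-PV? λ r → any-PV? λ s → isInducedPath? pyrAdj? _≟PV_ (p ∷ q ∷ r ∷ s ∷ [])} _

    pyramid-xv-apex-startsP5 : ∀ i → ∃₂ λ r s → ∃ λ t → IsInducedPath PyrAdj (xv i ∷ apex ∷ r ∷ s ∷ t ∷ [])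
    pyramid-xv-apex-startsP5 = toWitness {a? = all? λ i → any-PV? λ r → any-PV? λ s → any-PV? λ t →
      isInducedPath? pyrAdj? _≟PV_ (xv i ∷ apex ∷ r ∷ s ∷ t ∷ [])} _

    pyramid-yv-yv-startsP5 : ∀ i j → i ≢ j → ∃₂ λ r s → ∃ λ t → IsInducedPath PyrAdj (yv i ∷ yv j ∷ r ∷ s ∷ t ∷ [])
    pyramid-yv-yv-startsP5 = toWitness {a? = all? λ i → all? λ j → ¬? (i ≟ j) →-dec
      any-PV? λ r → any-PV? λ s → any-PV? λ t → isInducedPath? pyrAdj? _≟PV_ (yv i ∷ yv j ∷ r ∷ s ∷ t ∷ [])} _

module _ {n} {G : Graph n} (P : Pyramid G) where
  open import Data.Vec.Functional using (_∷_; [])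

  private
    e : PV → Fin n
    e = emb P

  adj⇒pyrAdj : ∀ {p q} → Adj G (e p) (e q) → PyrAdj p q
  adj⇒pyrAdj = Equivalence.to (adjIff P _ _)

  pyrAdj⇒adj : ∀ {p q} → PyrAdj p q → Adj G (e p) (e q)
  pyrAdj⇒adj = Equivalence.from (adjIff P _ _)

  inΠ? : ∀ v → Dec (InΠ G P v)
  inΠ? v = any-PV? (λ p → e p ≟ v)

  ΠNbhdClique : Fin n → Set
  ΠNbhdClique u = ∀ p q → Adj G u (e p) → Adj G u (e q) → p ≢ q → PyrAdj p q

  isClique⇒ΠNbhdClique : ∀ {u} → IsClique G (NΠ G P u) → ΠNbhdClique u
  isClique⇒ΠNbhdClique C p q up uq p≢q =
    adj⇒pyrAdj (C (e p) (e q) ((p , refl) , up) ((q , refl) , uq) (p≢q ∘ inj P))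

  ΠNbhdClique-misses : ∀ {u p} → ΠNbhdClique u → Adj G u (e p) → ∃ λ q → PyrAdj p q × ¬ Adj G u (e q)
  ΠNbhdClique-misses {u} {p} C up with pyramid-noSimplicialVertex p
  ... | q , q′ , pq , pq′ , q≢q′ , q≁q′ with adj? G u (e q)
  ...   | no  u≁q = q , pq , u≁q
  ...   | yes uq  = q′ , pq′ , λ uq′ → q≁q′ (C q q′ uq uq′ q≢q′)

  ΠNbhdClique-∷-inducedPath : ∀ {u k} {w : Fin (suc (suc k)) → PV} → ¬ InΠ G P u → ΠNbhdClique u →
                              IsInducedPath PyrAdj w → Adj G u (e (w zero)) → ¬ Adj G u (e (w (suc zero))) →
                              IsInducedPath (Adj G) (u ∷ e ∘ w)
  ΠNbhdClique-∷-inducedPath {u} {w = w} u∉Π C path u~w₀ u≁w₁ =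
    ∷-inducedPath G (InducedCopy-inducedPath P path) (λ i eq → u∉Π (w i , ≡-sym eq)) u~w₀ u≁
    where
    u≁ : ∀ i → ¬ Adj G u (e (w (suc i)))
    u≁ zero    = u≁w₁
    u≁ (suc i) u~w = far (Equivalence.to (adj⇔consecutive path zero (suc (suc i))) (C _ _ u~w₀ u~w w₀≢))
      where
      far : ¬ Consecutive zero (suc (suc i))
      far (inj₁ ())
      far (inj₂ ())
      w₀≢ : w zero ≢ w (suc (suc i))
      w₀≢ eq with injective path eq
      ... | ()

  reach-end : ∀ {S : VSet G} {s v} → Reach G S s v → S v
  reach-end (here s∈S)     = s∈S
  reach-end (step _ _ v∈S) = v∈S

  Π∌Z : ∀ p → ¬ Z G P (e p)
  Π∌Z p (e∉Π , _) = e∉Π (p , refl)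

  Π⊆G′ : ∀ p → InG' G P (e p)
  Π⊆G′ apex   = here (Π∌Z apex)
  Π⊆G′ (xv i) = step (Π⊆G′ apex) (pyrAdj⇒adj tt) (Π∌Z (xv i))
  Π⊆G′ (yv i) = step (step (Π⊆G′ apex) (pyrAdj⇒adj tt) (Π∌Z (xv i))) (pyrAdj⇒adj refl) (Π∌Z (yv i))

  notZ⇒clique : ∀ {v p} → ¬ Z G P v → ¬ InΠ G P v → Adj G v (e p) → IsClique G (NΠ G P v)
  notZ⇒clique {v} {p} v∉Z v∉Π vp x y vx vy x≢y with adj? G x y
  ... | yes xy  = xy
  ... | no  x≁y = ⊥-elim (v∉Z (v∉Π , (e p , (p , refl) , vp) , λ C → x≁y (C x y vx vy x≢y)))

  SeesBoth : PV × PV → Fin n → Set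
  SeesBoth (p , q) z = Adj G z (e p) × Adj G z (e q)

  seesBoth? : ∀ π z → Dec (SeesBoth π z)
  seesBoth? (p , q) z = adj? G z (e p) ×-dec adj? G z (e q)

  Z⇒seesNonEdge : ∀ {z} → Z G P z → Any (λ π → SeesBoth π z) nonEdges
  Z⇒seesNonEdge {z} (_ , _ , notClique) with Any.any? (λ π → seesBoth? π z) nonEdges
  ... | yes hit  = hit
  ... | no  none = ⊥-elim (notClique clique)
    where
    clique : IsClique G (NΠ G P z)
    clique _ _ ((p , refl) , zp) ((q , refl) , zq) ep≢eq with pyrAdj? p q
    ... | yes pq  = pyrAdj⇒adj pq
    ... | no  p≁q with ∈-orderedPairs (ep≢eq ∘ cong e) (∈-allPV p) (∈-allPV q)
    ...   | inj₁ pq∈ = ⊥-elim (none (lose (∈-filter⁺ nonEdge? pq∈ (ep≢eq ∘ cong e , p≁q)) (zp , zq)))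
    ...   | inj₂ qp∈ = ⊥-elim (none (lose (∈-filter⁺ nonEdge? qp∈ (ep≢eq ∘ cong e ∘ ≡-sym , p≁q ∘ pyrAdj-sym)) (zq , zp)))
      where
      pyrAdj-sym : PyrAdj q p → PyrAdj p q
      pyrAdj-sym = adj⇒pyrAdj ∘ sym G ∘ pyrAdj⇒adj

  Z-independent-bound : ∀ {t} → Free (K2Adj (suc t)) G → ∀ L → IndepIn G (Z G P) L → length L ≤ 12 * t
  Z-independent-bound {t} K2t-free L (uniq , L⊆Z , indep) = begin
    length L                                           ≤⟨ length≤sum-count seesBoth? nonEdges L
                                                            (All.tabulate (Z⇒seesNonEdge ∘ L⊆Z _)) ⟩
    sum (map (λ π → count seesBoth? π L) nonEdges)     ≤⟨ sum-map-≤-length* nonEdges commonBound ⟩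
    length nonEdges * t                                ≡⟨ cong (_* t) length-nonEdges ⟩
    12 * t                                             ∎
    where
    open Data.Nat.Properties.≤-Reasoning
    commonBound : ∀ π → π ∈ nonEdges → count seesBoth? π L ≤ t
    commonBound π@(p , q) π∈ = s≤s⁻¹ (commonNeighbours-< G K2t-free (p≢q ∘ inj P) (p≁q ∘ adj⇒pyrAdj)
      (filter (seesBoth? π) L) (Unique.filter⁺ (seesBoth? π) uniq)
      (λ z → proj₂ ∘ commonNbr⁻) (λ z z′ z∈ z′∈ → indep z z′ (proj₁ (commonNbr⁻ z∈)) (proj₁ (commonNbr⁻ z′∈))))
      where
      commonNbr⁻ : ∀ {z} → z ∈ filter (seesBoth? π) L → z ∈ L × SeesBoth π z
      commonNbr⁻ = ∈-filter⁻ (seesBoth? π) {xs = L}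
      nonEdge : NonEdge π
      nonEdge = proj₂ (∈-filter⁻ nonEdge? {xs = orderedPairs allPV} π∈)
      p≢q = proj₁ nonEdge
      p≁q = proj₂ nonEdge

  module _ (P6-free : Free P6Adj G) where

    attached-neighbour-attached : ∀ {u v p} → ¬ InΠ G P u → ΠNbhdClique u → Adj G u (e p) →
                                  Adj G u v → ¬ InΠ G P v → ∃ λ q → Adj G v (e q)
    attached-neighbour-attached {u} {v} {p} u∉Π C up uv v∉Π with any-PV? (λ q → adj? G v (e q))
    ... | yes found = found
    ... | no  none  with ΠNbhdClique-misses C up
    ...   | q , pq , u≁q with pyramid-edge-startsP4 p q pq
    ...     | r , s , path = ⊥-elim (P6-free (inducedPath⇒copy G (∷-inducedPath G
                               (ΠNbhdClique-∷-inducedPath u∉Π C path up u≁q) fresh (sym G uv) (λ i h → none (_ , h)))))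
      where
      fresh : ∀ i → v ≢ (u ∷ e ∘ (p ∷ q ∷ r ∷ s ∷ [])) i
      fresh zero    refl = irrefl G uv
      fresh (suc i) eq   = v∉Π (_ , ≡-sym eq)

    apexNonNeighbour-missesX : ∀ {v} → ¬ InΠ G P v → ΠNbhdClique v → ¬ Adj G v (e apex) →
                               ∀ i → ¬ Adj G v (e (xv i))
    apexNonNeighbour-missesX v∉Π C v≁a i vx with pyramid-xv-apex-startsP5 i
    ... | r , s , t , path = P6-free (inducedPath⇒copy G (ΠNbhdClique-∷-inducedPath v∉Π C path vx v≁a))

    apexNonNeighbour-seesY : ∀ {v p} → ¬ InΠ G P v → ΠNbhdClique v → ¬ Adj G v (e apex) →
                             Adj G v (e p) → ∀ j → Adj G v (e (yv j))
    apexNonNeighbour-seesY {v} {p} v∉Π C v≁a vp j with adj? G v (e (yv j))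
    ... | yes vy  = vy
    ... | no  v≁y = ⊥-elim (noΠNeighbour p vp)
      where
      noΠNeighbour : ∀ p → ¬ Adj G v (e p)
      noΠNeighbour apex   = v≁a
      noΠNeighbour (xv i) = apexNonNeighbour-missesX v∉Π C v≁a i
      noΠNeighbour (yv i) vy with pyramid-yv-yv-startsP5 i j (λ { refl → v≁y vy })
      ... | r , s , t , path = P6-free (inducedPath⇒copy G (ΠNbhdClique-∷-inducedPath v∉Π C path vy v≁y))

    G′-attached : ∀ {v} → InG' G P v → ¬ InΠ G P v → ∃ λ p → Adj G v (e p)
    G′-attached (here _) v∉Π = ⊥-elim (v∉Π (apex , refl))
    G′-attached (step {u} u∈G′ uv _) v∉Π with inΠ? u
    ... | yes (p , refl) = p , sym G uv
    ... | no  u∉Π with G′-attached u∈G′ u∉Π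
    ...   | p , up = attached-neighbour-attached u∉Π
                       (isClique⇒ΠNbhdClique (notZ⇒clique (reach-end u∈G′) u∉Π up)) up uv v∉Π

    G′-clique : ∀ {v} → InG' G P v → ¬ InΠ G P v → IsClique G (NΠ G P v)
    G′-clique v∈G′ v∉Π = notZ⇒clique (reach-end v∈G′) v∉Π (proj₂ (G′-attached v∈G′ v∉Π))

    simplicial : Simplicial' G P
    simplicial v v∈G′ v∉Π with G′-attached v∈G′ v∉Π
    ... | p , vp = (e p , Π⊆G′ p , (p , refl) , vp)
                 , λ x y x∈ y∈ → G′-clique v∈G′ v∉Π x y (proj₂ x∈) (proj₂ y∈)

    G′-classify : ∀ v → InG' G P v → InA G P v ⊎ InB G P v ⊎ InΠ G P v
    G′-classify v v∈G′ with inΠ? v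
    ... | yes v∈Π = inj₂ (inj₂ v∈Π)
    ... | no  v∉Π with adj? G v (e apex)
    ...   | yes va  = inj₁ (v∈G′ , v∉Π , Π⊆G′ apex , va)
    ...   | no  v≁a = inj₂ (inj₁ (v∈G′ , v∉Π , λ w → mk⇔ (sees⇒Y w) (Y⇒sees w)))
      where
      C : ΠNbhdClique v
      C = isClique⇒ΠNbhdClique (G′-clique v∈G′ v∉Π)
      sees⇒Y : ∀ w → NΠ' G P v w → InY G P w
      sees⇒Y _ (_ , (apex , refl) , va) = ⊥-elim (v≁a va)
      sees⇒Y _ (_ , (xv i , refl) , vx) = ⊥-elim (apexNonNeighbour-missesX v∉Π C v≁a i vx)
      sees⇒Y _ (_ , (yv i , refl) , _)  = i , refl
      Y⇒sees : ∀ w → InY G P w → NΠ' G P v w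
      Y⇒sees _ (i , refl) = Π⊆G′ (yv i) , (yv i , refl)
                          , apexNonNeighbour-seesY v∉Π C v≁a (proj₂ (G′-attached v∈G′ v∉Π)) i

    partition : PartitionG' G P
    partition = (λ _ → proj₁) , (λ _ → proj₁) , (λ { _ (p , refl) → Π⊆G′ p }) , G′-classify
              , A∩B , (λ _ (A , Π) → proj₁ (proj₂ A) Π) , (λ _ (B , Π) → proj₁ (proj₂ B) Π)
      where
      A∩B : ∀ v → ¬ (InA G P v × InB G P v)
      A∩B v ((_ , _ , _ , va) , (_ , _ , nbhd≡Y)) with Equivalence.to (nbhd≡Y (e apex)) (Π⊆G′ apex , (apex , refl) , va)
      ... | i , eq with inj P eq
      ... | ()

lemma4p1 : {n : ℕ} (G : Graph n) → Free P6Adj G → (P : Pyramid G) →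
    Simplicial' G P × PartitionG' G P
    × ((t : ℕ) → 2 ≤ t → Free (K2Adj t) G →
       (L : List (Fin n)) → IndepIn G (Z G P) L → length L ≤ 12 * (t ∸ 1))
lemma4p1 {n} G P6-free P = simplicial P P6-free , partition P P6-free , αZ-bound
  where
  αZ-bound : (t : ℕ) → 2 ≤ t → Free (K2Adj t) G →
             (L : List (Fin n)) → IndepIn G (Z G P) L → length L ≤ 12 * (t ∸ 1)
  αZ-bound (suc t) _ K2t-free = Z-independent-bound P K2t-free
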